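{- If $w=a^{n_1}b^{n_2}$ with $n_1,n_2\ge 1$ (where $a\ne b$ are letters), then all elements of $\mathtt{BR}(w)$ are rich.
   Context: $\mathtt{BR}(w)=\{B_t\cdots B_1 : w=B_1\cdots B_t,\ t\ge1,\ B_i \text{ non-empty words}\}$. A word $w$ is rich if it has exactly $|w|$ distinct non-empty palindromic factors. -}

module Defs where

open import Data.List using (List; []; _∷_; _++_; concat; reverse; length; replicate)
open import Data.List.Membership.Propositional using (_∈_)
open import Data.List.Relation.Unary.All using (All)
open import Data.List.Relation.Unary.Unique.Propositional using (Unique)
open import Data.Product using (Σ; ∃; _×_; _,_)
open import Relation.Binary.PropositionalEquality using (_≡_)
open import Relation.Nullary using (¬_)
open import Function.Bundles using (_⇔_)
open import Data.Nat using (ℕ)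

Factor : {A : Set} → List A → List A → Set
Factor {A} u w = Σ (List A) λ p → Σ (List A) λ s → p ++ u ++ s ≡ w

Palindrome : {A : Set} → List A → Set
Palindrome u = reverse u ≡ u

NonEmpty : {A : Set} → List A → Set
NonEmpty u = ¬ (u ≡ [])

PalFactor : {A : Set} → List A → List A → Set
PalFactor u w = NonEmpty u × Palindrome u × Factor u w

Rich : {A : Set} → List A → Set
Rich {A} w = Σ (List (List A)) λ L →
  Unique L × (∀ u → (u ∈ L ⇔ PalFactor u w)) × (length L ≡ length w)

InBR : {A : Set} → List A → List A → Set
InBR {A} v w = Σ (List (List A)) λ Bs →
  NonEmpty Bs × All NonEmpty Bs × concat Bs ≡ w × v ≡ concat (reverse Bs)

powWord : {A : Set} → A → ℕ → A → ℕ → List A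
powWord a n₁ b n₂ = replicate n₁ a ++ replicate n₂ b

-- Cutting aⁿ¹bⁿ² into blocks and reversing their order gives bᵖaᵠbʳaˢ, the block containing the
-- boundary becoming the middle aᵠbʳ; moreover q, r > 0 unless r = s = 0. The non-empty palindromic
-- factors of such a word are the runs bⁱ (i ≤ max(p,r)) and aⁱ (i ≤ max(q,s)) and the centred
-- words bⁱaᵠbⁱ (i ≤ min(p,r)) and aⁱbʳaⁱ (i ≤ min(q,s)): a palindrome cannot start and end in
-- runs of different letters, and one spanning a whole run must be centred on it. As
-- max + min = sum, there are exactly p + q + r + s of them.
module Submission where

open import Data.Empty using (⊥-elim)
open import Data.List using (List; []; _∷_; _++_; _∷ʳ_; [_]; concat; reverse; length; replicate; applyDownFrom; map; initLast; _∷ʳ′_)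
open import Data.List.Properties using (++-monoid; ++-assoc; ++-identityʳ; ∷-injective; ∷-injectiveˡ; ∷-injectiveʳ; reverse-++; unfold-reverse; length-++; length-replicate; length-applyDownFrom; concat-++)
open import Data.List.Membership.Propositional using (_∈_)
open import Data.List.Membership.Propositional.Properties using (∈-applyDownFrom⁺; ∈-applyDownFrom⁻; ∈-concat⁺; ∈-concat⁻)
open import Data.List.Relation.Unary.All using (All; []; _∷_)
open import Data.List.Relation.Unary.All.Properties as All using (replicate⁺; singleton⁻)
open import Data.List.Relation.Unary.Any using (here; there)
open import Data.List.Relation.Unary.AllPairs using ([]; _∷_)
open import Data.List.Relation.Unary.Unique.Propositional using (Unique)
open import Data.List.Relation.Unary.Unique.Propositional.Properties using (concat⁺; applyDownFrom⁺₁)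
open import Data.List.Relation.Binary.Disjoint.Propositional using (Disjoint)
open import Data.Nat using (ℕ; zero; suc; _+_; _≤_; _<_; _≥_; _⊔_; _⊓_; z≤n; s≤s; z<s)
open import Data.Nat.Properties using (≤-refl; ≤-trans; <-≤-trans; <-irrefl; <-trans; suc-injective; m<n⇒0<n; m<n⇒m<1+n; m≤m+n; m≤n+m; m≤n⇒∃[o]m+o≡n; +-comm; +-suc; +-identityʳ; ⊔-sel; m<n⇒m<n⊔o; m<n⇒m<o⊔n; m<n⊓o⇒m<n; m<n⊓o⇒m<o; ⊓-pres-m<)
open import Data.Nat.ListAction using (sum)
open import Data.Nat.Tactic.RingSolver using (solve-∀)
open import Data.Product using (Σ; ∃; ∃₂; _×_; _,_)
open import Data.Sum using (_⊎_; inj₁; inj₂; map₁)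
open import Function using (_∘_)
open import Function.Bundles using (mk⇔)
open import Relation.Binary.PropositionalEquality using (_≡_; _≢_; refl; sym; trans; cong; cong₂; subst; ≢-sym; module ≡-Reasoning)
open import Relation.Nullary using (¬_)

open import Defs

⊔+⊓≡+ : ∀ m n → m ⊔ n + m ⊓ n ≡ m + n
⊔+⊓≡+ zero    n       = +-identityʳ n
⊔+⊓≡+ (suc m) zero    = refl
⊔+⊓≡+ (suc m) (suc n) = cong suc (begin
  m ⊔ n + suc (m ⊓ n)  ≡⟨ +-suc (m ⊔ n) (m ⊓ n) ⟩
  suc (m ⊔ n + m ⊓ n)  ≡⟨ cong suc (⊔+⊓≡+ m n) ⟩
  suc (m + n)          ≡⟨ +-suc m n ⟨
  m + suc n            ∎)
  where open ≡-Reasoning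

<⊔⇒ : ∀ {i} m n → i < m ⊔ n → i < m ⊎ i < n
<⊔⇒ {i} m n i<m⊔n with ⊔-sel m n
... | inj₁ m⊔n≡m = inj₁ (subst (i <_) m⊔n≡m i<m⊔n)
... | inj₂ m⊔n≡n = inj₂ (subst (i <_) m⊔n≡n i<m⊔n)

disjoint-applyDownFrom : ∀ {A : Set} {f g : ℕ → A} {m n} →
  (∀ {i j} → i < m → j < n → f i ≢ g j) → Disjoint (applyDownFrom f m) (applyDownFrom g n)
disjoint-applyDownFrom {f = f} {g} f≢g (v∈f , v∈g)
  with i , i<m , refl ← ∈-applyDownFrom⁻ f v∈f | j , j<n , e ← ∈-applyDownFrom⁻ g v∈g = f≢g i<m j<n e

unique-applyDownFrom : ∀ {A : Set} (f : ℕ → A) n →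
  (∀ {i j} → i < n → j < n → f i ≡ f j → i ≡ j) → Unique (applyDownFrom f n)
unique-applyDownFrom f n f-injective =
  applyDownFrom⁺₁ f n (λ j<i i<n e → <-irrefl (sym (f-injective i<n (<-trans j<i i<n) e)) j<i)

length-concat : ∀ {A : Set} (xss : List (List A)) → length (concat xss) ≡ sum (map length xss)
length-concat []         = refl
length-concat (xs ∷ xss) = trans (length-++ xs) (cong (length xs +_) (length-concat xss))

module _ {X : Set} where

  open import Algebra.Solver.Monoid (++-monoid X) using (solve; _⊜_; _⊕_)

  Prefix : List X → List X → Set
  Prefix u w = Σ (List X) λ t → u ++ t ≡ w

  replicate-+ : ∀ m n (z : X) → replicate (m + n) z ≡ replicate m z ++ replicate n z
  replicate-+ zero    n z = refl
  replicate-+ (suc m) n z = cong (z ∷_) (replicate-+ m n z)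

  replicate-∷ʳ : ∀ n (z : X) → replicate n z ∷ʳ z ≡ z ∷ replicate n z
  replicate-∷ʳ zero    z = refl
  replicate-∷ʳ (suc n) z = cong (z ∷_) (replicate-∷ʳ n z)

  reverse-replicate : ∀ n (z : X) → reverse (replicate n z) ≡ replicate n z
  reverse-replicate zero    z = refl
  reverse-replicate (suc n) z = begin
    reverse (z ∷ replicate n z)   ≡⟨ unfold-reverse z (replicate n z) ⟩
    reverse (replicate n z) ∷ʳ z  ≡⟨ cong (_∷ʳ z) (reverse-replicate n z) ⟩
    replicate n z ∷ʳ z            ≡⟨ replicate-∷ʳ n z ⟩
    z ∷ replicate n z             ∎
    where open ≡-Reasoning

  replicate-injective : ∀ {m n} {z : X} → replicate m z ≡ replicate n z → m ≡ n
  replicate-injective {m} {n} e =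
    trans (sym (length-replicate m)) (trans (cong length e) (length-replicate n))

  ++≡replicate⁻ : ∀ {z : X} n u t → u ++ t ≡ replicate n z →
    ∃₂ λ i k → i + k ≡ n × u ≡ replicate i z × t ≡ replicate k z
  ++≡replicate⁻ n       []      t e = 0 , n , refl , refl , e
  ++≡replicate⁻ (suc n) (c ∷ u) t e with refl , e′ ← ∷-injective e
    with i , k , i+k≡n , refl , refl ← ++≡replicate⁻ n u t e′ =
    suc i , k , cong suc i+k≡n , refl , refl

  ++≡replicate-++⁻ : ∀ {z : X} n u t r → u ++ t ≡ replicate n z ++ r →
    (∃₂ λ i k → i + k ≡ n × u ≡ replicate i z × t ≡ replicate k z ++ r)
    ⊎ (∃ λ u′ → u ≡ replicate n z ++ u′ × u′ ++ t ≡ r)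
  ++≡replicate-++⁻ zero    u       t r e = inj₂ (u , refl , e)
  ++≡replicate-++⁻ (suc n) []      t r e = inj₁ (0 , suc n , refl , refl , e)
  ++≡replicate-++⁻ (suc n) (c ∷ u) t r e with refl , e′ ← ∷-injective e
    with ++≡replicate-++⁻ n u t r e′
  ... | inj₁ (i , k , i+k≡n , refl , t≡) = inj₁ (suc i , k , cong suc i+k≡n , refl , t≡)
  ... | inj₂ (u′ , refl , u′++t≡r)     = inj₂ (u′ , refl , u′++t≡r)

  factor-∷⁻ : ∀ {u w : List X} {c} → Factor u (c ∷ w) → Prefix u (c ∷ w) ⊎ Factor u w
  factor-∷⁻ ([]    , t , e) = inj₁ (t , e)
  factor-∷⁻ (_ ∷ v , t , e) = inj₂ (v , t , ∷-injectiveʳ e)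

  factor-++ˡ : ∀ {u w : List X} v → Factor u w → Factor u (v ++ w)
  factor-++ˡ v (l , t , e) = v ++ l , t , trans (++-assoc v l _) (cong (v ++_) e)

  factor-++ʳ : ∀ {u w : List X} v → Factor u w → Factor u (w ++ v)
  factor-++ʳ {u} v (l , t , e) =
    l , t ++ v , trans (solve 4 (λ a b c d → a ⊕ b ⊕ c ⊕ d ⊜ (a ⊕ b ⊕ c) ⊕ d) refl l u t v) (cong (_++ v) e)

  replicate-factor : ∀ {i n} (z : X) → i ≤ n → Factor (replicate i z) (replicate n z)
  replicate-factor {i} z i≤n with k , refl ← m≤n⇒∃[o]m+o≡n i≤n =
    [] , replicate k z , sym (replicate-+ i k z)

  replicate-centred-factor : ∀ {i p r} (z : X) m → i ≤ p → i ≤ r →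
    Factor (replicate i z ++ m ++ replicate i z) (replicate p z ++ m ++ replicate r z)
  replicate-centred-factor {i} z m i≤p i≤r
    with k , refl ← m≤n⇒∃[o]m+o≡n i≤p | l , refl ← m≤n⇒∃[o]m+o≡n i≤r =
    replicate k z , replicate l z , (begin
      zᵏ ++ (zⁱ ++ m ++ zⁱ) ++ zˡ    ≡⟨ solve 4 (λ a b c d → a ⊕ (b ⊕ c ⊕ b) ⊕ d ⊜ (a ⊕ b) ⊕ c ⊕ b ⊕ d) refl zᵏ zⁱ m zˡ ⟩
      (zᵏ ++ zⁱ) ++ m ++ zⁱ ++ zˡ    ≡⟨ cong₂ (λ a b → a ++ m ++ b)
                                        (trans (sym (replicate-+ k i z)) (cong (λ n → replicate n z) (+-comm k i)))
                                        (sym (replicate-+ i l z)) ⟩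
      replicate (i + k) z ++ m ++ replicate (i + l) z ∎)
    where
    open ≡-Reasoning
    zⁱ zᵏ zˡ : List X
    zⁱ = replicate i z
    zᵏ = replicate k z
    zˡ = replicate l z

  PrefixFromRun : ℕ → X → List X → List X → Set
  PrefixFromRun n z r u = ∃ λ j → j < n × Prefix u (replicate (suc j) z ++ r)

  factor-replicate-++⁻ : ∀ {u r : List X} {z} n →
    Factor u (replicate n z ++ r) → PrefixFromRun n z r u ⊎ Factor u r
  factor-replicate-++⁻ zero    f = inj₂ f
  factor-replicate-++⁻ (suc n) f with factor-∷⁻ f
  ... | inj₁ prefix = inj₁ (n , ≤-refl , prefix)
  ... | inj₂ f′     = map₁ (λ (j , j<n , prefix) → j , m<n⇒m<1+n j<n , prefix) (factor-replicate-++⁻ n f′)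

  factor-replicate⁻ : ∀ {u : List X} {z} n → NonEmpty u → Factor u (replicate n z) →
    ∃ λ i → i < n × u ≡ replicate (suc i) z
  factor-replicate⁻ {u} n u≢[] (l , t , e)
    with i , k , refl , _ , e′ ← ++≡replicate⁻ n l (u ++ t) e
    with ++≡replicate⁻ k u t e′
  ... | zero  , _ , _    , refl , _ = ⊥-elim (u≢[] refl)
  ... | suc j , m , refl , refl , _ = j , ≤-trans (m≤m+n (suc j) m) (m≤n+m _ i) , refl

  palindrome-replicate : ∀ n (z : X) → Palindrome (replicate n z)
  palindrome-replicate = reverse-replicate

  reverse-runs : ∀ i j (z : X) m →
    reverse (replicate i z ++ m ++ replicate j z) ≡ replicate j z ++ reverse m ++ replicate i z
  reverse-runs i j z m = begin
    reverse (zⁱ ++ m ++ zʲ)                     ≡⟨ reverse-++ zⁱ (m ++ zʲ) ⟩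
    reverse (m ++ zʲ) ++ reverse zⁱ             ≡⟨ cong₂ _++_ (reverse-++ m zʲ) (reverse-replicate i z) ⟩
    (reverse zʲ ++ reverse m) ++ zⁱ             ≡⟨ ++-assoc (reverse zʲ) (reverse m) zⁱ ⟩
    reverse zʲ ++ reverse m ++ zⁱ               ≡⟨ cong (_++ reverse m ++ zⁱ) (reverse-replicate j z) ⟩
    zʲ ++ reverse m ++ zⁱ                       ∎
    where
    open ≡-Reasoning
    zⁱ zʲ : List X
    zⁱ = replicate i z
    zʲ = replicate j z

  palindrome-centred : ∀ i (z : X) {m} → Palindrome m → Palindrome (replicate i z ++ m ++ replicate i z)
  palindrome-centred i z {m} pal = trans (reverse-runs i i z m) (cong (λ v → replicate i z ++ v ++ replicate i z) pal)

  leading-run-injective : ∀ {i j m} {z w : X} {t t′} → w ≢ z → 0 < m →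
    replicate i z ++ replicate m w ++ t ≡ replicate j z ++ replicate m w ++ t′ → i ≡ j
  leading-run-injective {zero}  {zero}  w≢z m>0       e = refl
  leading-run-injective {zero}  {suc j} w≢z (s≤s z≤n) e = ⊥-elim (w≢z (∷-injectiveˡ e))
  leading-run-injective {suc i} {zero}  w≢z (s≤s z≤n) e = ⊥-elim (w≢z (sym (∷-injectiveˡ e)))
  leading-run-injective {suc i} {suc j} w≢z m>0       e = cong suc (leading-run-injective w≢z m>0 (∷-injectiveʳ e))

  replicate≢runs : ∀ {i j m} {z w : X} {t} → w ≢ z → 0 < m →
    replicate i z ≢ replicate j z ++ replicate m w ++ t
  replicate≢runs {zero}  {zero}  w≢z (s≤s z≤n) ()
  replicate≢runs {zero}  {suc j} w≢z m>0       ()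
  replicate≢runs {suc i} {zero}  w≢z (s≤s z≤n) e = w≢z (sym (∷-injectiveˡ e))
  replicate≢runs {suc i} {suc j} w≢z m>0       e = replicate≢runs {i} {j} w≢z m>0 (∷-injectiveʳ e)

  palindrome-runs⇒≡ : ∀ {i j m} {z w : X} → w ≢ z →
    Palindrome (replicate i z ++ replicate (suc m) w ++ replicate j z) → i ≡ j
  palindrome-runs⇒≡ {i} {j} {m} {z} {w} w≢z pal = sym (leading-run-injective {m = suc m} w≢z (s≤s z≤n) (begin
    replicate j z ++ replicate (suc m) w ++ replicate i z            ≡⟨ cong (λ v → replicate j z ++ v ++ replicate i z)
                                                                         (reverse-replicate (suc m) w) ⟨
    replicate j z ++ reverse (replicate (suc m) w) ++ replicate i z  ≡⟨ reverse-runs i j z _ ⟨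
    reverse (replicate i z ++ replicate (suc m) w ++ replicate j z)  ≡⟨ pal ⟩
    replicate i z ++ replicate (suc m) w ++ replicate j z            ∎))
    where open ≡-Reasoning

  palindrome-last≡head : ∀ {z c : X} {u v} → Palindrome (z ∷ u) → z ∷ u ≡ v ∷ʳ c → c ≡ z
  palindrome-last≡head {z} {c} {u} {v} pal e = ∷-injectiveˡ (begin
    c ∷ reverse v     ≡⟨ reverse-++ v [ c ] ⟨
    reverse (v ∷ʳ c)  ≡⟨ cong reverse e ⟨
    reverse (z ∷ u)   ≡⟨ pal ⟩
    z ∷ u             ∎)
    where open ≡-Reasoning

  palindrome-suffix-avoiding-head : ∀ {z : X} {u} v t → Palindrome (z ∷ u) → z ∷ u ≡ v ++ t →
    All (_≢ z) t → t ≡ []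
  palindrome-suffix-avoiding-head v t pal e t≢z with initLast t
  ... | []        = refl
  ... | t′ ∷ʳ′ c  = ⊥-elim (singleton⁻ (All.++⁻ʳ t′ t≢z)
                      (palindrome-last≡head pal (trans e (sym (++-assoc v t′ [ c ])))))

  run-in-palindrome : ∀ {z : X} {u} v t s n r → Palindrome (z ∷ u) → z ∷ u ≡ v ++ t →
    t ++ s ≡ replicate n z ++ r → All (_≢ z) r → ∃ λ i → i ≤ n × t ≡ replicate i z
  run-in-palindrome {z} v t s n r pal e t++s≡ r≢z with ++≡replicate-++⁻ n t s r t++s≡
  ... | inj₁ (i , k , refl , t≡ , _) = i , m≤m+n i k , t≡
  ... | inj₂ (t′ , refl , t′++s≡r)
    with refl ← palindrome-suffix-avoiding-head (v ++ replicate n z) t′ pal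
                  (trans e (sym (++-assoc v (replicate n z) t′)))
                  (All.++⁻ˡ t′ (subst (All _) (sym t′++s≡r) r≢z)) =
    n , ≤-refl , ++-identityʳ _

  palindromic-prefix-of-run : ∀ {z : X} {u r} k → All (_≢ z) r → NonEmpty u → Palindrome u →
    Prefix u (replicate (suc k) z ++ r) → ∃ λ i → i < suc k × u ≡ replicate (suc i) z
  palindromic-prefix-of-run {u = []}    k r≢z u≢[] pal prefix = ⊥-elim (u≢[] refl)
  palindromic-prefix-of-run {u = c ∷ u} k r≢z u≢[] pal (s , e) with refl ← ∷-injectiveˡ e
    with run-in-palindrome [] (c ∷ u) s (suc k) _ pal refl e r≢z
  ... | suc i , i<suc-k , u≡ = i , i<suc-k , u≡

  palindromic-prefix-of-runs : ∀ {z w : X} {u r} k m n → w ≢ z → All (_≢ z) r → NonEmpty u → Palindrome u →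
    Prefix u (replicate (suc k) z ++ replicate (suc m) w ++ replicate n z ++ r) →
    (∃ λ i → i < suc k × u ≡ replicate (suc i) z)
    ⊎ (suc k ≤ n × u ≡ replicate (suc k) z ++ replicate (suc m) w ++ replicate (suc k) z)
  palindromic-prefix-of-runs {z} {w} {r = r} k m n w≢z r≢z u≢[] pal (s , e)
    with ++≡replicate-++⁻ (suc k) _ s _ e
  ... | inj₁ (zero  , _ , _    , refl , _) = ⊥-elim (u≢[] refl)
  ... | inj₁ (suc i , l , refl , refl , _) = inj₁ (i , m≤m+n (suc i) l , refl)
  ... | inj₂ (u₁ , refl , u₁++s≡) with ++≡replicate-++⁻ (suc m) u₁ s _ u₁++s≡
  ...   | inj₁ (i , _ , _ , refl , _)
    with refl ← replicate-injective {n = 0}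
                  (palindrome-suffix-avoiding-head (replicate (suc k) z) (replicate i w) pal refl (replicate⁺ i w≢z)) =
    inj₁ (k , ≤-refl , ++-identityʳ _)
  ...   | inj₂ (u₂ , refl , u₂++s≡)
    with i , i≤n , refl ← run-in-palindrome (replicate (suc k) z ++ replicate (suc m) w) u₂ s n r pal
                            (cong (z ∷_) (sym (++-assoc (replicate k z) (replicate (suc m) w) u₂))) u₂++s≡ r≢z
    with refl ← palindrome-runs⇒≡ {suc k} {i} {m} w≢z pal = inj₂ (i≤n , refl)

  concat-reverse-∷ : ∀ (b : List X) bs → concat (reverse (b ∷ bs)) ≡ concat (reverse bs) ++ b
  concat-reverse-∷ b bs = begin
    concat (reverse (b ∷ bs))        ≡⟨ cong concat (unfold-reverse b bs) ⟩
    concat (reverse bs ++ [ b ])     ≡⟨ concat-++ (reverse bs) [ b ] ⟨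
    concat (reverse bs) ++ b ++ []   ≡⟨ cong (concat (reverse bs) ++_) (++-identityʳ b) ⟩
    concat (reverse bs) ++ b         ∎
    where open ≡-Reasoning

  concat-reverse-replicate : ∀ {z : X} bs n → concat bs ≡ replicate n z → concat (reverse bs) ≡ replicate n z
  concat-reverse-replicate []       n e = e
  concat-reverse-replicate {z} (b ∷ bs) n e
    with i , k , refl , refl , e′ ← ++≡replicate⁻ n b (concat bs) e = begin
      concat (reverse (b ∷ bs))                   ≡⟨ concat-reverse-∷ b bs ⟩
      concat (reverse bs) ++ replicate i z        ≡⟨ cong (_++ replicate i z) (concat-reverse-replicate bs k e′) ⟩
      replicate k z ++ replicate i z              ≡⟨ replicate-+ k i z ⟨
      replicate (k + i) z                         ≡⟨ cong (λ n → replicate n z) (+-comm k i) ⟩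
      replicate (i + k) z                         ∎
    where open ≡-Reasoning

module FourRuns {X : Set} (x y : X) (x≢y : x ≢ y) where

  open import Algebra.Solver.Monoid (++-monoid X) using (solve; _⊜_; _⊕_; id)

  y≢x : y ≢ x
  y≢x = ≢-sym x≢y

  fourRuns : ℕ → ℕ → ℕ → ℕ → List X
  fourRuns p q r s = replicate p y ++ replicate q x ++ replicate r y ++ replicate s x

  NoGap : ℕ → ℕ → ℕ → Set
  NoGap q r s = (0 < q × 0 < r) ⊎ (r ≡ 0 × s ≡ 0)

  noGap⇒0<q : ∀ {q r s} → NoGap q r s → 0 < r → 0 < q
  noGap⇒0<q (inj₁ (0<q , _)) _ = 0<q
  noGap⇒0<q (inj₂ (refl , _)) ()

  noGap⇒0<r : ∀ {q r s} → NoGap q r s → 0 < s → 0 < r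
  noGap⇒0<r (inj₁ (_ , 0<r)) _ = 0<r
  noGap⇒0<r (inj₂ (_ , refl)) ()

  module Palindromes (p q r s : ℕ) where

    yRun xRun yxy xyx : ℕ → List X
    yRun i = replicate (suc i) y
    xRun i = replicate (suc i) x
    yxy  i = replicate (suc i) y ++ replicate q x ++ replicate (suc i) y
    xyx  i = replicate (suc i) x ++ replicate r y ++ replicate (suc i) x

    families : List (List (List X))
    families = applyDownFrom yRun (p ⊔ r) ∷ applyDownFrom xRun (q ⊔ s)
             ∷ applyDownFrom yxy (p ⊓ r) ∷ applyDownFrom xyx (q ⊓ s) ∷ []

    palindromes : List (List X)
    palindromes = concat families

    yRun-palFactor : ∀ {i} → i < p ⊔ r → PalFactor (yRun i) (fourRuns p q r s)
    yRun-palFactor {i} i<p⊔r = (λ ()) , palindrome-replicate (suc i) y , factor (<⊔⇒ p r i<p⊔r)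
      where
      factor : i < p ⊎ i < r → Factor (yRun i) (fourRuns p q r s)
      factor (inj₁ i<p) = factor-++ʳ _ (replicate-factor y i<p)
      factor (inj₂ i<r) = factor-++ˡ (replicate p y) (factor-++ˡ (replicate q x)
                            (factor-++ʳ (replicate s x) (replicate-factor y i<r)))

    xRun-palFactor : ∀ {i} → i < q ⊔ s → PalFactor (xRun i) (fourRuns p q r s)
    xRun-palFactor {i} i<q⊔s = (λ ()) , palindrome-replicate (suc i) x , factor (<⊔⇒ q s i<q⊔s)
      where
      factor : i < q ⊎ i < s → Factor (xRun i) (fourRuns p q r s)
      factor (inj₁ i<q) = factor-++ˡ (replicate p y) (factor-++ʳ _ (replicate-factor x i<q))
      factor (inj₂ i<s) = factor-++ˡ (replicate p y) (factor-++ˡ (replicate q x)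
                            (factor-++ˡ (replicate r y) (replicate-factor x i<s)))

    yxy-palFactor : ∀ {i} → i < p ⊓ r → PalFactor (yxy i) (fourRuns p q r s)
    yxy-palFactor {i} i<p⊓r =
      (λ ()) , palindrome-centred (suc i) y (palindrome-replicate q x) ,
      subst (Factor (yxy i)) reassociate
        (factor-++ʳ (replicate s x)
          (replicate-centred-factor y (replicate q x) (m<n⊓o⇒m<n p r i<p⊓r) (m<n⊓o⇒m<o p r i<p⊓r)))
      where
      reassociate : (replicate p y ++ replicate q x ++ replicate r y) ++ replicate s x ≡ fourRuns p q r s
      reassociate = solve 4 (λ a b c d → (a ⊕ b ⊕ c) ⊕ d ⊜ a ⊕ b ⊕ c ⊕ d) refl
        (replicate p y) (replicate q x) (replicate r y) (replicate s x)

    xyx-palFactor : ∀ {i} → i < q ⊓ s → PalFactor (xyx i) (fourRuns p q r s)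
    xyx-palFactor {i} i<q⊓s =
      (λ ()) , palindrome-centred (suc i) x (palindrome-replicate r y) ,
      factor-++ˡ (replicate p y)
        (replicate-centred-factor x (replicate r y) (m<n⊓o⇒m<n q s i<q⊓s) (m<n⊓o⇒m<o q s i<q⊓s))

    ∈-palindromes⁻ : ∀ {u} → u ∈ palindromes → PalFactor u (fourRuns p q r s)
    ∈-palindromes⁻ u∈ with ∈-concat⁻ families u∈
    ... | here u∈F                   with _ , i< , refl ← ∈-applyDownFrom⁻ yRun u∈F = yRun-palFactor i<
    ... | there (here u∈F)           with _ , i< , refl ← ∈-applyDownFrom⁻ xRun u∈F = xRun-palFactor i<
    ... | there (there (here u∈F))   with _ , i< , refl ← ∈-applyDownFrom⁻ yxy u∈F = yxy-palFactor i<
    ... | there (there (there (here u∈F))) with _ , i< , refl ← ∈-applyDownFrom⁻ xyx u∈F = xyx-palFactor i<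

    yRun∈ : ∀ {i} → i < p ⊔ r → yRun i ∈ palindromes
    yRun∈ i< = ∈-concat⁺ {xss = families} (here (∈-applyDownFrom⁺ yRun i<))

    xRun∈ : ∀ {i} → i < q ⊔ s → xRun i ∈ palindromes
    xRun∈ i< = ∈-concat⁺ {xss = families} (there (here (∈-applyDownFrom⁺ xRun i<)))

    yxy∈ : ∀ {i} → i < p ⊓ r → yxy i ∈ palindromes
    yxy∈ i< = ∈-concat⁺ {xss = families} (there (there (here (∈-applyDownFrom⁺ yxy i<))))

    xyx∈ : ∀ {i} → i < q ⊓ s → xyx i ∈ palindromes
    xyx∈ i< = ∈-concat⁺ {xss = families} (there (there (there (here (∈-applyDownFrom⁺ xyx i<)))))

    palFactor⇒∈-palindromes : ∀ {u} → NoGap q r s → PalFactor u (fourRuns p q r s) → u ∈ palindromes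
    palFactor⇒∈-palindromes {u} noGap (u≢[] , pal , f) with factor-replicate-++⁻ p f
    ... | inj₁ (j , j<p , prefix) = fromFirstRun noGap
      where
      fromFirstRun : NoGap q r s → u ∈ palindromes
      fromFirstRun (inj₁ (s≤s {n = q′} z≤n , _))
        with palindromic-prefix-of-runs j q′ r x≢y (replicate⁺ s x≢y) u≢[] pal prefix
      ... | inj₁ (i , i≤j , refl)  = yRun∈ (m<n⇒m<n⊔o r (<-≤-trans i≤j j<p))
      ... | inj₂ (j<r , refl)      = yxy∈ (⊓-pres-m< j<p j<r)
      fromFirstRun (inj₂ (refl , refl))
        with i , i≤j , refl ← palindromic-prefix-of-run j (All.++⁺ (replicate⁺ q x≢y) []) u≢[] pal prefix =
        yRun∈ (m<n⇒m<n⊔o r (<-≤-trans i≤j j<p))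
    ... | inj₂ f₁ with factor-replicate-++⁻ q f₁
    ...   | inj₁ (j , j<q , t , e) = fromSecondRun noGap
      where
      fromSecondRun : NoGap q r s → u ∈ palindromes
      fromSecondRun (inj₁ (_ , s≤s {n = r′} z≤n))
        with palindromic-prefix-of-runs j r′ s y≢x [] u≢[] pal
               (t , trans e (cong (λ v → replicate (suc j) x ++ replicate r y ++ v) (sym (++-identityʳ _))))
      ... | inj₁ (i , i≤j , refl)  = xRun∈ (m<n⇒m<n⊔o s (<-≤-trans i≤j j<q))
      ... | inj₂ (j<s , refl)      = xyx∈ (⊓-pres-m< j<q j<s)
      fromSecondRun (inj₂ (refl , refl))
        with i , i≤j , refl ← palindromic-prefix-of-run j [] u≢[] pal (t , e) =
        xRun∈ (m<n⇒m<n⊔o s (<-≤-trans i≤j j<q))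
    ...   | inj₂ f₂ with factor-replicate-++⁻ r f₂
    ...     | inj₁ (j , j<r , prefix)
              with i , i≤j , refl ← palindromic-prefix-of-run j (replicate⁺ s x≢y) u≢[] pal prefix =
              yRun∈ (m<n⇒m<o⊔n p (<-≤-trans i≤j j<r))
    ...     | inj₂ f₃ with i , i<s , refl ← factor-replicate⁻ s u≢[] f₃ = xRun∈ (m<n⇒m<o⊔n q i<s)

    palindromes-unique : NoGap q r s → Unique palindromes
    palindromes-unique noGap = concat⁺ {xss = families}
      (unique-applyDownFrom yRun _ (λ _ _ → suc-injective ∘ replicate-injective)
       ∷ unique-applyDownFrom xRun _ (λ _ _ → suc-injective ∘ replicate-injective)
       ∷ unique-applyDownFrom yxy _ (λ i< _ → suc-injective ∘ leading-run-injective x≢y (0<q i<))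
       ∷ unique-applyDownFrom xyx _ (λ i< _ → suc-injective ∘ leading-run-injective y≢x (0<r i<))
       ∷ [])
      ( (disjoint-applyDownFrom (λ _ _ → y≢x ∘ ∷-injectiveˡ)
         ∷ disjoint-applyDownFrom (λ {j = j} _ j< → replicate≢runs {j = suc j} x≢y (0<q j<))
         ∷ disjoint-applyDownFrom (λ _ _ → y≢x ∘ ∷-injectiveˡ) ∷ [])
      ∷ (disjoint-applyDownFrom (λ _ _ → x≢y ∘ ∷-injectiveˡ)
         ∷ disjoint-applyDownFrom (λ {j = j} _ j< → replicate≢runs {j = suc j} y≢x (0<r j<)) ∷ [])
      ∷ (disjoint-applyDownFrom (λ _ _ → y≢x ∘ ∷-injectiveˡ) ∷ [])
      ∷ [] ∷ [])
      where
      0<q : ∀ {i} → i < p ⊓ r → 0 < q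
      0<q i< = noGap⇒0<q noGap (m<n⇒0<n (m<n⊓o⇒m<o p r i<))
      0<r : ∀ {i} → i < q ⊓ s → 0 < r
      0<r i< = noGap⇒0<r noGap (m<n⇒0<n (m<n⊓o⇒m<o q s i<))

    length-palindromes : length palindromes ≡ length (fourRuns p q r s)
    length-palindromes = begin
      length (concat families)                            ≡⟨ length-concat families ⟩
      sum (map length families)                           ≡⟨ cong sum lengths ⟩
      p ⊔ r + (q ⊔ s + (p ⊓ r + (q ⊓ s + 0)))             ≡⟨ regroup (p ⊔ r) (p ⊓ r) (q ⊔ s) (q ⊓ s) ⟩
      (p ⊔ r + p ⊓ r) + (q ⊔ s + q ⊓ s)                   ≡⟨ cong₂ _+_ (⊔+⊓≡+ p r) (⊔+⊓≡+ q s) ⟩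
      (p + r) + (q + s)                                   ≡⟨ interleave p q r s ⟩
      p + (q + (r + s))                                   ≡⟨ length-fourRuns ⟨
      length (fourRuns p q r s)                           ∎
      where
      open ≡-Reasoning
      lengths : map length families ≡ p ⊔ r ∷ q ⊔ s ∷ p ⊓ r ∷ q ⊓ s ∷ []
      lengths = cong₂ _∷_ (length-applyDownFrom yRun _) (cong₂ _∷_ (length-applyDownFrom xRun _)
                  (cong₂ _∷_ (length-applyDownFrom yxy _) (cong₂ _∷_ (length-applyDownFrom xyx _) refl)))
      regroup : ∀ a b c d → a + (c + (b + (d + 0))) ≡ (a + b) + (c + d)
      regroup = solve-∀
      interleave : ∀ a b c d → (a + c) + (b + d) ≡ a + (b + (c + d))
      interleave = solve-∀
      length-fourRuns : length (fourRuns p q r s) ≡ p + (q + (r + s))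
      length-fourRuns =
        trans (length-++ (replicate p y)) (cong₂ _+_ (length-replicate p)
          (trans (length-++ (replicate q x)) (cong₂ _+_ (length-replicate q)
            (trans (length-++ (replicate r y)) (cong₂ _+_ (length-replicate r) (length-replicate s))))))

  fourRuns-rich : ∀ p {q r s} → NoGap q r s → Rich (fourRuns p q r s)
  fourRuns-rich p {q} {r} {s} noGap =
    palindromes , palindromes-unique noGap ,
    (λ _ → mk⇔ ∈-palindromes⁻ (palFactor⇒∈-palindromes noGap)) , length-palindromes
    where open Palindromes p q r s

  FourRunShape : List X → Set
  FourRunShape v = Σ ℕ λ p → Σ ℕ λ q → Σ ℕ λ r → Σ ℕ λ s → NoGap q r s × v ≡ fourRuns p q r s

  fourRunShape⇒rich : ∀ {v} → FourRunShape v → Rich v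
  fourRunShape⇒rich (p , _ , _ , _ , noGap , refl) = fourRuns-rich p noGap

  fourRunShape-++ʳ : ∀ {v} → FourRunShape v → ∀ i → FourRunShape (v ++ replicate i x)
  fourRunShape-++ʳ (p , q , r , s , inj₁ 0<q×0<r , refl) i =
    p , q , r , s + i , inj₁ 0<q×0<r ,
    trans (solve 5 (λ a b c d e → (a ⊕ b ⊕ c ⊕ d) ⊕ e ⊜ a ⊕ b ⊕ c ⊕ d ⊕ e) refl
             (replicate p y) (replicate q x) (replicate r y) (replicate s x) (replicate i x))
          (cong (λ v → replicate p y ++ replicate q x ++ replicate r y ++ v) (sym (replicate-+ s i x)))
  fourRunShape-++ʳ (p , q , r , s , inj₂ (refl , refl) , refl) i =
    p , q + i , 0 , 0 , inj₂ (refl , refl) ,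
    trans (solve 3 (λ a b e → (a ⊕ b ⊕ id) ⊕ e ⊜ a ⊕ (b ⊕ e) ⊕ id) refl
             (replicate p y) (replicate q x) (replicate i x))
          (cong (λ v → replicate p y ++ v ++ []) (sym (replicate-+ q i x)))

  fourRunShape-yxy : ∀ k n j → FourRunShape (replicate k y ++ replicate n x ++ replicate j y)
  fourRunShape-yxy k n       zero    = k , n , 0 , 0 , inj₂ (refl , refl) , refl
  fourRunShape-yxy k zero    (suc j) =
    k + suc j , 0 , 0 , 0 , inj₂ (refl , refl) , trans (sym (replicate-+ k (suc j) y)) (sym (++-identityʳ _))
  fourRunShape-yxy k (suc n) (suc j) =
    k , suc n , suc j , 0 , inj₁ (z<s , z<s) ,
    cong (λ v → replicate k y ++ replicate (suc n) x ++ v) (sym (++-identityʳ _))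

  reverse-blocks-shape : ∀ bs {n m} → 0 < m → concat bs ≡ powWord x n y m → FourRunShape (concat (reverse bs))
  reverse-blocks-shape []       {zero}  (s≤s z≤n) ()
  reverse-blocks-shape []       {suc n} _         ()
  reverse-blocks-shape (b ∷ bs) {n} {m} 0<m e with ++≡replicate-++⁻ n b (concat bs) (replicate m y) e
  ... | inj₁ (i , k , _ , refl , e′) =
    subst FourRunShape (sym (concat-reverse-∷ b bs)) (fourRunShape-++ʳ (reverse-blocks-shape bs 0<m e′) i)
  ... | inj₂ (u , refl , e′) with j , k , _ , refl , e″ ← ++≡replicate⁻ m u (concat bs) e′ =
    subst FourRunShape
      (sym (trans (concat-reverse-∷ b bs) (cong (_++ b) (concat-reverse-replicate bs k e″))))
      (fourRunShape-yxy k n j)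

proposition4p2 : {A : Set} (a b : A) → ¬ (a ≡ b) → (n₁ n₂ : ℕ) → n₁ ≥ 1 → n₂ ≥ 1 →
    (v : List A) → InBR v (powWord a n₁ b n₂) → Rich v
proposition4p2 a b a≢b n₁ n₂ _ 0<n₂ v (bs , _ , _ , concat≡w , v≡) =
  subst Rich (sym v≡) (fourRunShape⇒rich (reverse-blocks-shape bs 0<n₂ concat≡w))
  where open FourRuns a b a≢b
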